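{- Let $V$ be a set of $n$ vertices and let $\mathcal{G}=\{G_1,\dots,G_k\}$ be a directed evolving graph with $G_i=(V,E_i)$, $E_i\subseteq V\times V$, and let $\mu=\max_i|E_i|$. Consider the following algorithm (Algorithm 1), which computes the edge set $E^*$ of the strict transitive closure of $\mathcal{G}$: (1) for every $v\in V$, set $\mathcal{P}(v)\gets\{v\}$ and $\mathcal{P}^+(v)\gets\emptyset$; (2) for $i=1,\dots,k$: set $U\gets\emptyset$; for each $(u,v)\in E_i$, set $\mathcal{P}^+(v)\gets\mathcal{P}^+(v)\cup\mathcal{P}(u)$ and $U\gets U\cup\{v\}$; then for each $v\in U$, set $\mathcal{P}(v)\gets\mathcal{P}(v)\cup\mathcal{P}^+(v)$ and $\mathcal{P}^+(v)\gets\emptyset$; then scan the vertices $v\in V$, stopping the scan at the first $v$ with $|\mathcal{P}(v)|<|V|$; if no such $v$ exists, halt and return all pairs $(u,v)\in V\times V$ with $u\neq v$; (3) otherwise, after all $k$ steps, return $E^*=\{(u,v): v\in V,\ u\in\mathcal{P}(v)\setminus\{v\}\}$. Assume that set union costs time at most linear in the total number of elements of the two sets involved and that the size of a set is available in constant time. Then Algorithm 1 runs in time $O(k\mu n)$.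
   Context: A strict journey from $u$ to $v$ in $\mathcal{G}$ is a sequence of directed edges $e_1,\dots,e_p$ forming a path from $u$ to $v$ together with indices $i_1<\dots<i_p$ such that $e_j\in E_{i_j}$ for all $j$. The strict transitive closure of $\mathcal{G}$ is the static directed graph $(V,E^*)$ where $(u,v)\in E^*$ iff $u\neq v$ and there is a strict journey from $u$ to $v$. Here $k=|\mathcal{G}|$ is the number of steps and $\mu$ the maximum number of edges present at any single step. -}

module Defs where

open import Data.Nat using (ℕ; zero; suc; _+_; _*_; _<_; _<ᵇ_; _⊔_)
open import Data.Bool using (Bool; true; false; if_then_else_)
open import Data.Fin using (Fin; _≟_)
open import Data.Fin.Subset using (Subset; _∪_; ⁅_⁆; ∣_∣; inside; outside)
import Data.Fin.Subset as S
open import Data.Product using (_×_; _,_; proj₁; proj₂)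
open import Data.List using (List; []; _∷_; length; allFin; concatMap; filter; foldl)
open import Data.Vec using (Vec; lookup; replicate; tabulate; _[_]≔_)
open import Relation.Nullary using (does; ¬_)
open import Relation.Nullary.Decidable using (¬?)
open import Data.Fin.Subset.Properties using (_∈?_)

-- Directed evolving graph on vertex set V = Fin n with k steps:
-- G = (E_1 , … , E_k), each E_i given as a (duplicate-free, see the
-- statement) list of directed edges (u , v).

Edge : ℕ → Set
Edge n = Fin n × Fin n

EvolvingGraph : ℕ → ℕ → Set
EvolvingGraph n k = Vec (List (Edge n)) k

μ : ∀ {n k} → EvolvingGraph n k → ℕ
μ Vec.[] = 0
μ (E Vec.∷ G) = length E ⊔ μ G

-- Instrumented Algorithm 1.
-- Cost model: union A ∪ B costs |A| + |B|; |A| costs O(1) (charged 1);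
-- every elementary step (loop iteration, assignment, test, output of one
-- pair) is charged 1.

record State (n : ℕ) : Set where
  constructor st
  field
    P    : Vec (Subset n) n
    P⁺   : Vec (Subset n) n
    U    : Subset n
    cost : ℕ
open State

init : (n : ℕ) → State n
init n = st (tabulate ⁅_⁆) (replicate n S.⊥) S.⊥ n

processEdge : ∀ {n} → State n → Edge n → State n
processEdge (st P P⁺ U c) (u , v) =
  st P
     (P⁺ [ v ]≔ (lookup P⁺ v ∪ lookup P u))
     (U ∪ ⁅ v ⁆)
     (c + (1 + ∣ lookup P⁺ v ∣ + ∣ lookup P u ∣) + (1 + ∣ U ∣ + 1))

-- for each v ∈ U: P(v) ← P(v) ∪ P⁺(v); P⁺(v) ← ∅
-- (only members of U are charged, modelling iteration over U itself)
commitVertex : ∀ {n} → State n → Fin n → State n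
commitVertex s@(st P P⁺ U c) v with lookup U v
... | outside = s
... | inside  =
  st (P [ v ]≔ (lookup P v ∪ lookup P⁺ v))
     (P⁺ [ v ]≔ S.⊥)
     U
     (c + (1 + ∣ lookup P v ∣ + ∣ lookup P⁺ v ∣) + 1)

doStep : ∀ {n} → State n → List (Edge n) → State n
doStep {n} (st P P⁺ U c) E =
  foldl commitVertex (foldl processEdge (st P P⁺ S.⊥ (c + 1)) E) (allFin n)

scan : ∀ {n} → Vec (Subset n) n → List (Fin n) → Bool × ℕ
scan P [] = false , 0
scan {n} P (v ∷ vs) with ∣ lookup P v ∣ <ᵇ n
... | true  = true , 1
... | false = let r = scan P vs in proj₁ r , suc (proj₂ r)

allPairs : (n : ℕ) → List (Edge n)
allPairs n = concatMap (λ u → Data.List.map (u ,_)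
                 (filter (λ v → ¬? (u ≟ v)) (allFin n))) (allFin n)
  where import Data.List

finalPairs : ∀ {n} → Vec (Subset n) n → List (Edge n)
finalPairs {n} P = concatMap (λ v → Data.List.map (_, v)
                 (filter (λ u → ¬? (u ≟ v))
                   (filter (λ u → u ∈? lookup P v) (allFin n)))) (allFin n)
  where import Data.List

-- cost of producing E*: for each v, computing P(v) ∖ {v} costs
-- |P(v)| + 1 and enumerating it costs |P(v)|, plus 1 per vertex
finalCost : ∀ {n} → Vec (Subset n) n → ℕ
finalCost {n} P = foldl (λ c v → c + (1 + ∣ lookup P v ∣ + 1 + ∣ lookup P v ∣)) 0 (allFin n)

loop : ∀ {n k} → State n → EvolvingGraph n k → List (Edge n) × ℕ
loop s Vec.[] = finalPairs (P s) , cost s + finalCost (P s)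
loop {n} s (E Vec.∷ G) with doStep s E
... | s′ with scan (P s′) (allFin n)
...   | (true  , c) = loop (record s′ { cost = cost s′ + c }) G
...   | (false , c) = allPairs n , cost s′ + c + n * n

algorithm1 : ∀ {n k} → EvolvingGraph n k → List (Edge n) × ℕ
algorithm1 {n} G = loop (init n) G

runningTime : ∀ {n k} → EvolvingGraph n k → ℕ
runningTime G = proj₂ (algorithm1 G)

-- Amortised analysis with the potential Φ = Σ_v |P(v)| + Σ_v |P⁺(v)|.
-- Every operation of a step is charged O(n) per edge of E_i: one union per
-- edge, and one union per vertex of U, where |U| ≤ |E_i|.  The potential
-- grows by at most n per edge (only P⁺(v) ∪ P(u) can enlarge it; committing
-- P⁺(v) into P(v) does not), so the final output, whose cost is O(n + Φ),
-- and the early halt, which happens only when Φ ≥ n², are both paid for by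
-- a budget of O(n) initially plus O(μ n) per step.
module Submission where

open import Defs
open import Data.Bool using (true; false; T)
open import Data.Fin using (Fin; zero; suc)
open import Data.Fin.Subset using (Subset; Side; _∪_; ∣_∣; inside; outside; ⁅_⁆)
import Data.Fin.Subset as Subset
open import Data.Fin.Subset.Properties using (∣p∣≤n; ∣⊥∣≡0; ∣⁅x⁆∣≡1)
open import Data.List using (List; []; _∷_; foldl; allFin; length)
import Data.List as List
import Data.List.Properties as List
open import Data.List.Relation.Unary.Unique.Propositional using (Unique)
open import Data.Nat using (ℕ; zero; suc; _+_; _*_; _≤_; _<ᵇ_; z≤n; s≤s)
open import Data.Nat.ListAction using (sum)
open import Data.Nat.Properties
open import Data.Nat.Tactic.RingSolver using (solve-∀)
open import Data.Product using (∃; _,_; proj₁; proj₂)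
open import Data.Vec using (Vec; []; _∷_; lookup; _[_]≔_; tabulate; replicate)
import Data.Vec as Vec
open import Function using (_∘_)
open import Relation.Binary.PropositionalEquality
open State

sideToℕ : Side → ℕ
sideToℕ inside  = 1
sideToℕ outside = 0

∣p∣≡sum-sideToℕ : ∀ {n} (p : Subset n) → ∣ p ∣ ≡ Vec.sum (Vec.map sideToℕ p)
∣p∣≡sum-sideToℕ []            = refl
∣p∣≡sum-sideToℕ (inside ∷ p)  = cong suc (∣p∣≡sum-sideToℕ p)
∣p∣≡sum-sideToℕ (outside ∷ p) = ∣p∣≡sum-sideToℕ p

∣p∪q∣≤∣p∣+∣q∣ : ∀ {n} (p q : Subset n) → ∣ p ∪ q ∣ ≤ ∣ p ∣ + ∣ q ∣
∣p∪q∣≤∣p∣+∣q∣ []            []            = z≤n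
∣p∪q∣≤∣p∣+∣q∣ (inside ∷ p)  (outside ∷ q) = s≤s (∣p∪q∣≤∣p∣+∣q∣ p q)
∣p∪q∣≤∣p∣+∣q∣ (inside ∷ p)  (inside ∷ q)  =
  s≤s (≤-trans (∣p∪q∣≤∣p∣+∣q∣ p q) (+-monoʳ-≤ ∣ p ∣ (n≤1+n ∣ q ∣)))
∣p∪q∣≤∣p∣+∣q∣ (outside ∷ p) (inside ∷ q)  =
  ≤-trans (s≤s (∣p∪q∣≤∣p∣+∣q∣ p q)) (≤-reflexive (sym (+-suc ∣ p ∣ ∣ q ∣)))
∣p∪q∣≤∣p∣+∣q∣ (outside ∷ p) (outside ∷ q) = ∣p∪q∣≤∣p∣+∣q∣ p q

sum-map-lookup-allFin : ∀ {A : Set} {m} (f : A → ℕ) (xs : Vec A m) →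
                        sum (List.map (f ∘ lookup xs) (allFin m)) ≡ Vec.sum (Vec.map f xs)
sum-map-lookup-allFin f xs =
  trans (cong sum (List.map-tabulate (λ v → v) (f ∘ lookup xs))) (sum-tabulate xs)
  where
  sum-tabulate : ∀ {m} (xs : Vec _ m) →
                 sum (List.tabulate (f ∘ lookup xs)) ≡ Vec.sum (Vec.map f xs)
  sum-tabulate []       = refl
  sum-tabulate (x ∷ xs) = cong (f x +_) (sum-tabulate xs)

foldl-+≡+sum : ∀ {A : Set} (f : A → ℕ) c (xs : List A) →
               foldl (λ c x → c + f x) c xs ≡ c + sum (List.map f xs)
foldl-+≡+sum f c []       = sym (+-identityʳ c)
foldl-+≡+sum f c (x ∷ xs) = trans (foldl-+≡+sum f (c + f x) xs) (+-assoc c (f x) _)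

foldl-increment : ∀ {A B : Set} (g : A → B → A) (m : A → ℕ) {d} →
                  (∀ a b → m (g a b) ≤ m a + d) →
                  ∀ a bs → m (foldl g a bs) ≤ m a + length bs * d
foldl-increment g m         step a []       = ≤-reflexive (sym (+-identityʳ (m a)))
foldl-increment g m {d} step a (b ∷ bs) = begin
  m (foldl g (g a b) bs)        ≤⟨ foldl-increment g m step (g a b) bs ⟩
  m (g a b) + length bs * d     ≤⟨ +-monoˡ-≤ _ (step a b) ⟩
  m a + d + length bs * d       ≡⟨ +-assoc (m a) d _ ⟩
  m a + length (b ∷ bs) * d     ∎
  where open ≤-Reasoning

totalSize : ∀ {n m} → Vec (Subset n) m → ℕ
totalSize P = Vec.sum (Vec.map ∣_∣ P)

totalSize-[]≔ : ∀ {n m} (P : Vec (Subset n) m) i p →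
                totalSize (P [ i ]≔ p) + ∣ lookup P i ∣ ≡ totalSize P + ∣ p ∣
totalSize-[]≔ (q ∷ P) zero    p = exchange (∣ p ∣) (totalSize P) (∣ q ∣)
  where
  exchange : ∀ a r b → (a + r) + b ≡ (b + r) + a
  exchange = solve-∀
totalSize-[]≔ (q ∷ P) (suc i) p = begin
  ∣ q ∣ + totalSize (P [ i ]≔ p) + ∣ lookup P i ∣   ≡⟨ +-assoc ∣ q ∣ _ _ ⟩
  ∣ q ∣ + (totalSize (P [ i ]≔ p) + ∣ lookup P i ∣) ≡⟨ cong (∣ q ∣ +_) (totalSize-[]≔ P i p) ⟩
  ∣ q ∣ + (totalSize P + ∣ p ∣)                     ≡⟨ +-assoc ∣ q ∣ _ _ ⟨
  ∣ q ∣ + totalSize P + ∣ p ∣                       ∎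
  where open ≡-Reasoning

-- Amortised cost of one step

potential : ∀ {n} → State n → ℕ
potential s = totalSize (P s) + totalSize (P⁺ s)

amortisedCost : ∀ {n} → State n → ℕ
amortisedCost {n} s = cost s + 2 * (n + potential s)

edgeCost commitCost : ℕ → ℕ
edgeCost   n = 3 * suc n
commitCost n = 2 * suc n

cost-processEdge : ∀ {n} (s : State n) e → cost (processEdge s e) ≤ cost s + edgeCost n
cost-processEdge {n} (st P P⁺ U c) (u , v) = begin
  c + (1 + ∣ lookup P⁺ v ∣ + ∣ lookup P u ∣) + (1 + ∣ U ∣ + 1)
    ≤⟨ +-mono-≤ (+-monoʳ-≤ c (+-mono-≤ (+-monoʳ-≤ 1 (∣p∣≤n (lookup P⁺ v))) (∣p∣≤n (lookup P u))))
                (+-monoˡ-≤ 1 (+-monoʳ-≤ 1 (∣p∣≤n U))) ⟩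
  c + (1 + n + n) + (1 + n + 1)  ≡⟨ collect c n ⟩
  c + edgeCost n                 ∎
  where
  open ≤-Reasoning
  collect : ∀ c n → c + (1 + n + n) + (1 + n + 1) ≡ c + 3 * suc n
  collect = solve-∀

∣U∣-processEdge : ∀ {n} (s : State n) e → ∣ U (processEdge s e) ∣ ≤ ∣ U s ∣ + 1
∣U∣-processEdge (st P P⁺ U c) (u , v) =
  ≤-trans (∣p∪q∣≤∣p∣+∣q∣ U ⁅ v ⁆) (≤-reflexive (cong (∣ U ∣ +_) (∣⁅x⁆∣≡1 v)))

potential-processEdge : ∀ {n} (s : State n) e → potential (processEdge s e) ≤ potential s + n
potential-processEdge {n} (st P P⁺ U c) (u , v) = begin
  totalSize P + totalSize (P⁺ [ v ]≔ new) ≤⟨ +-monoʳ-≤ (totalSize P) P⁺-grows ⟩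
  totalSize P + (totalSize P⁺ + n)        ≡⟨ +-assoc (totalSize P) _ n ⟨
  totalSize P + totalSize P⁺ + n          ∎
  where
  open ≤-Reasoning
  new = lookup P⁺ v ∪ lookup P u
  P⁺-grows : totalSize (P⁺ [ v ]≔ new) ≤ totalSize P⁺ + n
  P⁺-grows = +-cancelʳ-≤ ∣ lookup P⁺ v ∣ _ _ (begin
    totalSize (P⁺ [ v ]≔ new) + ∣ lookup P⁺ v ∣    ≡⟨ totalSize-[]≔ P⁺ v new ⟩
    totalSize P⁺ + ∣ new ∣                         ≤⟨ +-monoʳ-≤ (totalSize P⁺) (∣p∪q∣≤∣p∣+∣q∣ (lookup P⁺ v) (lookup P u)) ⟩
    totalSize P⁺ + (∣ lookup P⁺ v ∣ + ∣ lookup P u ∣) ≤⟨ +-monoʳ-≤ (totalSize P⁺) (+-monoʳ-≤ ∣ lookup P⁺ v ∣ (∣p∣≤n (lookup P u))) ⟩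
    totalSize P⁺ + (∣ lookup P⁺ v ∣ + n)            ≡⟨ exchange (totalSize P⁺) ∣ lookup P⁺ v ∣ n ⟩
    totalSize P⁺ + n + ∣ lookup P⁺ v ∣              ∎)
    where
    exchange : ∀ a b c → a + (b + c) ≡ a + c + b
    exchange = solve-∀

U-commitVertex : ∀ {n} (s : State n) v → U (commitVertex s v) ≡ U s
U-commitVertex s v with lookup (U s) v
... | outside = refl
... | inside  = refl

cost-commitVertex : ∀ {n} (s : State n) v →
                    cost (commitVertex s v) ≤ cost s + sideToℕ (lookup (U s) v) * commitCost n
cost-commitVertex {n} s v with lookup (U s) v
... | outside = ≤-reflexive (sym (+-identityʳ (cost s)))
... | inside  = begin
  cost s + (1 + ∣ lookup (P s) v ∣ + ∣ lookup (P⁺ s) v ∣) + 1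
    ≤⟨ +-monoˡ-≤ 1 (+-monoʳ-≤ (cost s) (+-mono-≤ (+-monoʳ-≤ 1 (∣p∣≤n (lookup (P s) v))) (∣p∣≤n (lookup (P⁺ s) v)))) ⟩
  cost s + (1 + n + n) + 1       ≡⟨ collect (cost s) n ⟩
  cost s + 1 * commitCost n      ∎
  where
  open ≤-Reasoning
  collect : ∀ c n → c + (1 + n + n) + 1 ≡ c + 1 * (2 * suc n)
  collect = solve-∀

-- P(v) grows by at most |P⁺(v)|, which is exactly what P⁺(v) loses.
potential-commitVertex : ∀ {n} (s : State n) v → potential (commitVertex s v) ≤ potential s
potential-commitVertex {n} s v with lookup (U s) v
... | outside = ≤-refl
... | inside  = begin
  p′ + q′      ≤⟨ +-monoˡ-≤ q′ P-grows ⟩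
  p + d + q′   ≡⟨ trans (+-assoc p d q′) (cong (p +_) (+-comm d q′)) ⟩
  p + (q′ + d) ≡⟨ cong (p +_) (trans (totalSize-[]≔ (P⁺ s) v Subset.⊥) (cong (q +_) (∣⊥∣≡0 n))) ⟩
  p + (q + 0)  ≡⟨ cong (p +_) (+-identityʳ q) ⟩
  p + q        ∎
  where
  open ≤-Reasoning
  Pv  = lookup (P s) v
  P⁺v = lookup (P⁺ s) v
  p  = totalSize (P s)
  q  = totalSize (P⁺ s)
  d  = ∣ P⁺v ∣
  p′ = totalSize (P s [ v ]≔ (Pv ∪ P⁺v))
  q′ = totalSize (P⁺ s [ v ]≔ Subset.⊥)
  P-grows : p′ ≤ p + d
  P-grows = +-cancelʳ-≤ ∣ Pv ∣ _ _ (begin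
    p′ + ∣ Pv ∣          ≡⟨ totalSize-[]≔ (P s) v (Pv ∪ P⁺v) ⟩
    p + ∣ Pv ∪ P⁺v ∣     ≤⟨ +-monoʳ-≤ p (∣p∪q∣≤∣p∣+∣q∣ Pv P⁺v) ⟩
    p + (∣ Pv ∣ + d)     ≡⟨ trans (cong (p +_) (+-comm ∣ Pv ∣ d)) (sym (+-assoc p d ∣ Pv ∣)) ⟩
    p + d + ∣ Pv ∣       ∎)

cost-commitVertices : ∀ {n} (s : State n) vs →
  cost (foldl commitVertex s vs) ≤ cost s + sum (List.map (sideToℕ ∘ lookup (U s)) vs) * commitCost n
cost-commitVertices s [] = ≤-reflexive (sym (+-identityʳ (cost s)))
cost-commitVertices {n} s (v ∷ vs) = begin
  cost (foldl commitVertex s′ vs)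
    ≤⟨ cost-commitVertices s′ vs ⟩
  cost s′ + sum (List.map (sideToℕ ∘ lookup (U s′)) vs) * commitCost n
    ≡⟨ cong (λ W → cost s′ + sum (List.map (sideToℕ ∘ lookup W) vs) * commitCost n) (U-commitVertex s v) ⟩
  cost s′ + rest * commitCost n
    ≤⟨ +-monoˡ-≤ _ (cost-commitVertex s v) ⟩
  cost s + here * commitCost n + rest * commitCost n
    ≡⟨ distribute (cost s) here rest (commitCost n) ⟩
  cost s + (here + rest) * commitCost n ∎
  where
  open ≤-Reasoning
  s′   = commitVertex s v
  here = sideToℕ (lookup (U s) v)
  rest = sum (List.map (sideToℕ ∘ lookup (U s)) vs)
  distribute : ∀ c a b k → c + a * k + b * k ≡ c + (a + b) * k
  distribute = solve-∀

cost-commitAll : ∀ {n} (s : State n) →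
                 cost (foldl commitVertex s (allFin n)) ≤ cost s + ∣ U s ∣ * commitCost n
cost-commitAll {n} s = subst (λ u → cost (foldl commitVertex s (allFin n)) ≤ cost s + u * commitCost n)
  (trans (sum-map-lookup-allFin sideToℕ (U s)) (sym (∣p∣≡sum-sideToℕ (U s))))
  (cost-commitVertices s (allFin n))

potential-commitVertices : ∀ {n} (s : State n) vs → potential (foldl commitVertex s vs) ≤ potential s
potential-commitVertices s []       = ≤-refl
potential-commitVertices s (v ∷ vs) =
  ≤-trans (potential-commitVertices (commitVertex s v) vs) (potential-commitVertex s v)

cost-doStep : ∀ {n} (s : State n) E →
              cost (doStep s E) ≤ cost s + 1 + length E * (edgeCost n + commitCost n)
cost-doStep {n} s E = begin
  cost (doStep s E)                                  ≤⟨ cost-commitAll s₁ ⟩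
  cost s₁ + ∣ U s₁ ∣ * commitCost n                  ≤⟨ +-mono-≤ edges (*-monoˡ-≤ (commitCost n) ∣U₁∣≤∣E∣) ⟩
  cost s + 1 + length E * edgeCost n + length E * commitCost n ≡⟨ distribute (cost s + 1) (length E) _ _ ⟩
  cost s + 1 + length E * (edgeCost n + commitCost n) ∎
  where
  open ≤-Reasoning
  s₀ = st (P s) (P⁺ s) Subset.⊥ (cost s + 1)
  s₁ = foldl processEdge s₀ E
  edges : cost s₁ ≤ cost s + 1 + length E * edgeCost n
  edges = foldl-increment processEdge cost cost-processEdge s₀ E
  ∣U₁∣≤∣E∣ : ∣ U s₁ ∣ ≤ length E
  ∣U₁∣≤∣E∣ = begin
    ∣ U s₁ ∣                          ≤⟨ foldl-increment processEdge (∣_∣ ∘ U) ∣U∣-processEdge s₀ E ⟩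
    ∣ Subset.⊥ {n} ∣ + length E * 1  ≡⟨ cong₂ _+_ (∣⊥∣≡0 n) (*-identityʳ (length E)) ⟩
    length E                          ∎
  distribute : ∀ c m a b → c + m * a + m * b ≡ c + m * (a + b)
  distribute = solve-∀

potential-doStep : ∀ {n} (s : State n) E → potential (doStep s E) ≤ potential s + length E * n
potential-doStep {n} s E =
  ≤-trans (potential-commitVertices s₁ (allFin n))
          (foldl-increment processEdge potential potential-processEdge s₀ E)
  where
  s₀ = st (P s) (P⁺ s) Subset.⊥ (cost s + 1)
  s₁ = foldl processEdge s₀ E

edgeWeight : ℕ → ℕ
edgeWeight n = edgeCost n + commitCost n + 2 * n

amortisedCost-doStep : ∀ {n} (s : State n) E →
                       amortisedCost (doStep s E) ≤ amortisedCost s + 1 + length E * edgeWeight n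
amortisedCost-doStep {n} s E = begin
  cost (doStep s E) + 2 * (n + potential (doStep s E))
    ≤⟨ +-mono-≤ (cost-doStep s E) (*-monoʳ-≤ 2 (+-monoʳ-≤ n (potential-doStep s E))) ⟩
  cost s + 1 + length E * (edgeCost n + commitCost n) + 2 * (n + (potential s + length E * n))
    ≡⟨ regroup (cost s) n (potential s) (length E) (edgeCost n + commitCost n) ⟩
  cost s + 2 * (n + potential s) + 1 + length E * edgeWeight n ∎
  where
  open ≤-Reasoning
  regroup : ∀ c n φ m w → c + 1 + m * w + 2 * (n + (φ + m * n))
                        ≡ c + 2 * (n + φ) + 1 + m * (w + 2 * n)
  regroup = solve-∀

-- The main loop

scan-cost : ∀ {n} (P : Vec (Subset n) n) vs → proj₂ (scan P vs) ≤ length vs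
scan-cost P [] = z≤n
scan-cost {n} P (v ∷ vs) with ∣ lookup P v ∣ <ᵇ n
... | true  = s≤s z≤n
... | false = s≤s (scan-cost P vs)

scan-false : ∀ {n} (P : Vec (Subset n) n) vs → proj₁ (scan P vs) ≡ false →
             length vs * n ≤ sum (List.map (∣_∣ ∘ lookup P) vs)
scan-false P [] _ = z≤n
scan-false {n} P (v ∷ vs) all-full with ∣ lookup P v ∣ <ᵇ n in full
... | false = +-mono-≤ (≮⇒≥ (λ lt → subst T full (<⇒<ᵇ lt))) (scan-false P vs all-full)

scan-cost-allFin : ∀ {n} (P : Vec (Subset n) n) → proj₂ (scan P (allFin n)) ≤ n
scan-cost-allFin {n} P =
  subst (proj₂ (scan P (allFin n)) ≤_) (List.length-tabulate (λ v → v)) (scan-cost P (allFin n))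

scan-false-allFin : ∀ {n} (P : Vec (Subset n) n) → proj₁ (scan P (allFin n)) ≡ false →
                    n * n ≤ totalSize P
scan-false-allFin {n} P all-full =
  subst₂ (λ m t → m * n ≤ t) (List.length-tabulate {n = n} (λ v → v)) (sum-map-lookup-allFin ∣_∣ P)
         (scan-false P (allFin n) all-full)

finalCost≡ : ∀ {n} (P : Vec (Subset n) n) → finalCost P ≡ 2 * (n + totalSize P)
finalCost≡ {n} P = begin
  finalCost P                                   ≡⟨ foldl-+≡+sum (outputCost ∘ lookup P) 0 (allFin n) ⟩
  sum (List.map (outputCost ∘ lookup P) (allFin n)) ≡⟨ sum-map-lookup-allFin outputCost P ⟩
  Vec.sum (Vec.map outputCost P)                ≡⟨ sum-outputCost P ⟩
  2 * (n + totalSize P)                         ∎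
  where
  open ≡-Reasoning
  outputCost : Subset n → ℕ
  outputCost p = 1 + ∣ p ∣ + 1 + ∣ p ∣
  sum-outputCost : ∀ {m} (P : Vec (Subset n) m) → Vec.sum (Vec.map outputCost P) ≡ 2 * (m + totalSize P)
  sum-outputCost []      = refl
  sum-outputCost {suc m} (p ∷ P) =
    trans (cong (outputCost p +_) (sum-outputCost P)) (regroup (∣ p ∣) m (totalSize P))
    where
    regroup : ∀ a m t → 1 + a + 1 + a + 2 * (m + t) ≡ 2 * (suc m + (a + t))
    regroup = solve-∀

stepBound : ℕ → ℕ → ℕ
stepBound n M = 1 + M * edgeWeight n + n

amortisedCost-step : ∀ {n} M (s : State n) E → length E ≤ M →
                     amortisedCost (doStep s E) + n ≤ amortisedCost s + stepBound n M
amortisedCost-step {n} M s E ∣E∣≤M = begin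
  amortisedCost (doStep s E) + n                  ≤⟨ +-monoˡ-≤ n (amortisedCost-doStep s E) ⟩
  amortisedCost s + 1 + length E * edgeWeight n + n ≤⟨ +-monoˡ-≤ n (+-monoʳ-≤ _ (*-monoˡ-≤ (edgeWeight n) ∣E∣≤M)) ⟩
  amortisedCost s + 1 + M * edgeWeight n + n      ≡⟨ regroup (amortisedCost s) (M * edgeWeight n) n ⟩
  amortisedCost s + stepBound n M                 ∎
  where
  open ≤-Reasoning
  regroup : ∀ a w n → a + 1 + w + n ≡ a + (1 + w + n)
  regroup = solve-∀

cost-output : ∀ {n} (s : State n) → cost s + finalCost (P s) ≤ amortisedCost s
cost-output {n} s = +-monoʳ-≤ (cost s)
  (≤-trans (≤-reflexive (finalCost≡ (P s)))
           (*-monoʳ-≤ 2 (+-monoʳ-≤ n (m≤m+n (totalSize (P s)) (totalSize (P⁺ s))))))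

cost-resume : ∀ {n} (s : State n) c → c ≤ n →
              amortisedCost (record s { cost = cost s + c }) ≤ amortisedCost s + n
cost-resume {n} s c c≤n = begin
  cost s + c + 2 * (n + potential s) ≤⟨ +-monoˡ-≤ _ (+-monoʳ-≤ (cost s) c≤n) ⟩
  cost s + n + 2 * (n + potential s) ≡⟨ exchange (cost s) n _ ⟩
  amortisedCost s + n                ∎
  where
  open ≤-Reasoning
  exchange : ∀ a b c → a + b + c ≡ a + c + b
  exchange = solve-∀

cost-halt : ∀ {n} (s : State n) c → c ≤ n → n * n ≤ totalSize (P s) →
            cost s + c + n * n ≤ amortisedCost s + n
cost-halt {n} s c c≤n n²≤∣P∣ = begin
  cost s + c + n * n                   ≤⟨ +-mono-≤ (+-monoʳ-≤ (cost s) c≤n) (≤-trans n²≤∣P∣ (m≤m+n _ _)) ⟩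
  cost s + n + potential s             ≤⟨ m≤m+n _ (n + potential s + n) ⟩
  cost s + n + potential s + (n + potential s + n) ≡⟨ regroup (cost s) n (potential s) ⟩
  amortisedCost s + n                  ∎
  where
  open ≤-Reasoning
  regroup : ∀ c n φ → c + n + φ + (n + φ + n) ≡ c + 2 * (n + φ) + n
  regroup = solve-∀

cost-loop : ∀ {n k} M (G : EvolvingGraph n k) (s : State n) → μ G ≤ M →
            proj₂ (loop s G) ≤ amortisedCost s + k * stepBound n M
cost-loop M [] s _ = ≤-trans (cost-output s) (m≤m+n _ 0)
cost-loop {n} {suc k} M (E ∷ G) s μ≤M
  with doStep s E | amortisedCost-step M s E (≤-trans (m≤m⊔n (length E) (μ G)) μ≤M)
... | s′ | step
  with scan (P s′) (allFin n) | scan-cost-allFin (P s′) | scan-false-allFin (P s′)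
... | true , c | c≤n | _ = begin
  proj₂ (loop s″ G)                           ≤⟨ cost-loop M G s″ (≤-trans (m≤n⊔m (length E) (μ G)) μ≤M) ⟩
  amortisedCost s″ + k * D                    ≤⟨ +-monoˡ-≤ (k * D) (≤-trans (cost-resume s′ c c≤n) step) ⟩
  amortisedCost s + D + k * D                 ≡⟨ +-assoc (amortisedCost s) D (k * D) ⟩
  amortisedCost s + suc k * D                 ∎
  where
  open ≤-Reasoning
  D  = stepBound n M
  s″ = record s′ { cost = cost s′ + c }
... | false , c | c≤n | n²≤∣P∣ = begin
  cost s′ + c + n * n                 ≤⟨ ≤-trans (cost-halt s′ c c≤n (n²≤∣P∣ refl)) step ⟩
  amortisedCost s + D                 ≤⟨ +-monoʳ-≤ (amortisedCost s) (m≤m+n D (k * D)) ⟩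
  amortisedCost s + suc k * D         ∎
  where
  open ≤-Reasoning
  D = stepBound n M

totalSize-singletons : ∀ {n m} (f : Fin m → Subset n) → (∀ i → ∣ f i ∣ ≡ 1) →
                       totalSize (tabulate f) ≡ m
totalSize-singletons {m = zero}  f ∣f∣≡1 = refl
totalSize-singletons {m = suc m} f ∣f∣≡1 =
  cong₂ _+_ (∣f∣≡1 zero) (totalSize-singletons (f ∘ suc) (∣f∣≡1 ∘ suc))

totalSize-empties : ∀ {n} m → totalSize (replicate m (Subset.⊥ {n})) ≡ 0
totalSize-empties {n} zero    = refl
totalSize-empties {n} (suc m) = cong₂ _+_ (∣⊥∣≡0 n) (totalSize-empties m)

amortisedCost-init : ∀ n → amortisedCost (init n) ≡ 5 * n
amortisedCost-init n = begin
  n + 2 * (n + (totalSize (tabulate (⁅_⁆ {n})) + totalSize (replicate n (Subset.⊥ {n}))))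
    ≡⟨ cong (λ φ → n + 2 * (n + φ)) (cong₂ _+_ (totalSize-singletons ⁅_⁆ ∣⁅x⁆∣≡1) (totalSize-empties n)) ⟩
  n + 2 * (n + (n + 0)) ≡⟨ collect n ⟩
  5 * n                 ∎
  where
  open ≡-Reasoning
  collect : ∀ n → n + 2 * (n + (n + 0)) ≡ 5 * n
  collect = solve-∀

μ-noVertices : ∀ {k} (G : EvolvingGraph 0 k) → μ G ≡ 0
μ-noVertices []                 = refl
μ-noVertices ([] ∷ G)           = μ-noVertices G
μ-noVertices (((() , _) ∷ E) ∷ G)

polynomial-bound : ∀ n k M → 1 ≤ n → 1 ≤ k → 1 ≤ M →
                   5 * n + k * stepBound n M ≤ 19 * (k * M * n)
polynomial-bound n@(suc _) k@(suc _) M@(suc _) _ _ _ = begin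
  5 * n + k * stepBound n M                   ≡⟨ expand n k M ⟩
  5 * n + k + 5 * (k * M) + 7 * (k * M * n) + k * n
    ≤⟨ +-mono-≤ (+-mono-≤ (+-mono-≤ (+-mono-≤ (*-monoʳ-≤ 5 n≤X) k≤X) (*-monoʳ-≤ 5 kM≤X)) ≤-refl) kn≤X ⟩
  5 * X + X + 5 * X + 7 * X + X               ≡⟨ collect X ⟩
  19 * X                                      ∎
  where
  open ≤-Reasoning
  X = k * M * n
  n≤X  = m≤n*m n (k * M)
  kM≤X = m≤m*n (k * M) n
  k≤X  = ≤-trans (m≤m*n k M) kM≤X
  kn≤X = *-monoˡ-≤ n (m≤m*n k M)
  expand : ∀ n k M → 5 * n + k * (1 + M * (3 * suc n + 2 * suc n + 2 * n) + n)
                   ≡ 5 * n + k + 5 * (k * M) + 7 * (k * M * n) + k * n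
  expand = solve-∀
  collect : ∀ X → 5 * X + X + 5 * X + 7 * X + X ≡ 19 * X
  collect = solve-∀

theorem1 : ∃ λ (C : ℕ) → ∀ (n k : ℕ) (G : EvolvingGraph n k) →
    (∀ (i : Fin k) → Unique (lookup G i)) →
    1 ≤ μ G →
    runningTime G ≤ C * (k * μ G * n)
theorem1 = 19 , bound
  where
  bound : ∀ n k (G : EvolvingGraph n k) → (∀ i → Unique (lookup G i)) → 1 ≤ μ G →
          runningTime G ≤ 19 * (k * μ G * n)
  bound zero    k       G  _ 1≤μ with () ← ≤-trans 1≤μ (≤-reflexive (μ-noVertices G))
  bound (suc _) zero    [] _ ()
  bound n@(suc _) k@(suc _) G _ 1≤μ = begin
    runningTime G                            ≤⟨ cost-loop (μ G) G (init n) ≤-refl ⟩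
    amortisedCost (init n) + k * stepBound n (μ G) ≡⟨ cong (_+ k * stepBound n (μ G)) (amortisedCost-init n) ⟩
    5 * n + k * stepBound n (μ G)            ≤⟨ polynomial-bound n k (μ G) (s≤s z≤n) (s≤s z≤n) 1≤μ ⟩
    19 * (k * μ G * n)                       ∎
    where open ≤-Reasoning
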